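{- Let $\mathbf A=(A,\wedge,\vee,\cdot,\backslash,\slash)$ be a unital residuated binar whose lattice reduct is a Boolean lattice. Then the following six identities are pairwise equivalent for $\mathbf A$ (i.e., $\mathbf A$ satisfies one of them if and only if it satisfies all of them): $$x (y\wedge z) = x y\wedge x z,\quad (x\wedge y) z = x z\wedge y z,\quad x\backslash (y\vee z) = x\backslash y\vee x\backslash z,$$ $$(x\vee y)\slash z = x\slash z\vee y\slash z,\quad (x\wedge y)\backslash z = x\backslash z\vee y\backslash z,\quad x\slash (y\wedge z) = x\slash y\vee x\slash z.$$
   Context: A residuated binar is an algebra $\mathbf A=(A,\wedge,\vee,\cdot,\backslash,\slash)$ where $(A,\wedge,\vee)$ is a lattice, $\cdot$ is a binary operation on $A$ (written $xy$), and for all $x,y,z\in A$: $x\cdot y\le z \iff x\le z\slash y \iff y\le x\backslash z$. It is unital if $\cdot$ has an identity element. Convention: $\cdot$ binds more tightly than $\backslash,\slash$, which bind more tightly than $\wedge,\vee$. -}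

module Defs where

open import Level using (Level; _⊔_) renaming (suc to lsuc)
open import Data.Product using (Σ; ∃; _×_)
open import Data.Fin using (Fin; zero; suc)
open import Function.Bundles using (_⇔_)
open import Relation.Binary.Core using (Rel)
open import Algebra.Core using (Op₁; Op₂)
open import Algebra.Definitions using (Congruent₂; Identity)
open import Algebra.Lattice.Structures using (IsLattice; IsBooleanAlgebra)

-- Notation:  x ⧵ y  is  x\y  (left residual),  x ⧸ y  is  x/y  (right residual).
record UnitalResiduatedBinar (c ℓ : Level) : Set (lsuc (c ⊔ ℓ)) where
  infixl 7 _·_
  infixr 6 _⧵_ _⧸_
  infixr 5 _∧_
  infixr 4 _∨_
  infix 3 _≈_ _≤_
  field
    Carrier   : Set c
    _≈_       : Rel Carrier ℓ
    _∧_       : Op₂ Carrier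
    _∨_       : Op₂ Carrier
    _·_       : Op₂ Carrier
    _⧵_       : Op₂ Carrier
    _⧸_       : Op₂ Carrier
    e         : Carrier
    isLattice : IsLattice _≈_ _∨_ _∧_
    ·-cong    : Congruent₂ _≈_ _·_
    ⧵-cong    : Congruent₂ _≈_ _⧵_
    ⧸-cong    : Congruent₂ _≈_ _⧸_
    ·-identity : Identity _≈_ e _·_

  _≤_ : Rel Carrier ℓ
  x ≤ y = (x ∧ y) ≈ x

  field
    residuatedˡ : ∀ x y z → (x · y ≤ z) ⇔ (x ≤ z ⧸ y)
    residuatedʳ : ∀ x y z → (x · y ≤ z) ⇔ (y ≤ x ⧵ z)

  IsBooleanReduct : Set (c ⊔ ℓ)
  IsBooleanReduct =
    Σ (Op₁ Carrier) λ ¬ → Σ Carrier λ ⊤ → Σ Carrier λ ⊥ →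
      IsBooleanAlgebra _≈_ _∨_ _∧_ ¬ ⊤ ⊥

  Identity₆ : Fin 6 → Set (c ⊔ ℓ)
  Identity₆ zero =
    ∀ x y z → x · (y ∧ z) ≈ x · y ∧ x · z
  Identity₆ (suc zero) =
    ∀ x y z → (x ∧ y) · z ≈ x · z ∧ y · z
  Identity₆ (suc (suc zero)) =
    ∀ x y z → x ⧵ (y ∨ z) ≈ x ⧵ y ∨ x ⧵ z
  Identity₆ (suc (suc (suc zero))) =
    ∀ x y z → (x ∨ y) ⧸ z ≈ x ⧸ z ∨ y ⧸ z
  Identity₆ (suc (suc (suc (suc zero)))) =
    ∀ x y z → (x ∧ y) ⧵ z ≈ x ⧵ z ∨ y ⧵ z
  Identity₆ (suc (suc (suc (suc (suc zero))))) =
    ∀ x y z → x ⧸ (y ∧ z) ≈ x ⧸ y ∨ x ⧸ z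

{-# OPTIONS --safe #-}
module Submission where

-- Every one of the six identities forces x · y ≈ x ∧ y, and when · = ∧ in a Boolean lattice
-- all six hold, because then x ⧵ y ≈ ¬ x ∨ y. For the forward direction it suffices that
-- ⊤ · w ≤ w for all w: this gives e ≈ ⊤, hence x · y ≤ x ∧ y, while x ∧ y ≤ x · y follows
-- from y ≈ (¬ x ∨ x) · y. Splitting ⊤ = e ∨ ¬ e reduces that condition to ¬ e · ⊤ ≤ ⊥, which
-- the identities (x ∧ y) · z ≈ x · z ∧ y · z and (x ∧ y) ⧵ z ≈ x ⧵ z ∨ y ⧵ z yield at e and ¬ e;
-- x ⧵ (y ∨ z) ≈ x ⧵ y ∨ x ⧵ z yields it directly at w and ¬ w. The other three identities are
-- these three for the opposite algebra, whose multiplication is y · x.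

open import Defs
open import Level using (Level; _⊔_)
open import Data.Fin using (Fin; zero; suc)
open import Data.Product using (_,_; proj₁; proj₂)
open import Function.Base using (_∘_)
open import Relation.Binary.Core using (Rel)
open import Function.Bundles using (module Equivalence)
open import Algebra.Bundles using (IdempotentCommutativeMonoid)
open import Algebra.Lattice.Bundles using (BooleanAlgebra)
open import Algebra.Lattice.Structures using (IsLattice)
import Algebra.Definitions
import Algebra.Lattice.Properties.BooleanAlgebra as BooleanAlgebraProperties
import Algebra.Properties.IdempotentCommutativeMonoid as IdempotentCommutativeMonoidProperties
import Relation.Binary.Lattice as OrderTheoretic
import Relation.Binary.Lattice.Properties.JoinSemilattice as JoinSemilatticeProperties
import Relation.Binary.Reasoning.PartialOrder as ≤-Reasoning
import Relation.Binary.Reasoning.Setoid as ≈-Reasoning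

opposite : ∀ {c ℓ} → UnitalResiduatedBinar c ℓ → UnitalResiduatedBinar c ℓ
opposite A = record
  { Carrier     = Carrier
  ; _≈_         = _≈_
  ; _∧_         = _∧_
  ; _∨_         = _∨_
  ; _·_         = λ x y → y · x
  ; _⧵_         = λ x z → z ⧸ x
  ; _⧸_         = λ z y → y ⧵ z
  ; e           = e
  ; isLattice   = isLattice
  ; ·-cong      = λ p q → ·-cong q p
  ; ⧵-cong      = λ p q → ⧸-cong q p
  ; ⧸-cong      = λ p q → ⧵-cong q p
  ; ·-identity  = proj₂ ·-identity , proj₁ ·-identity
  ; residuatedˡ = λ x y z → residuatedʳ y x z
  ; residuatedʳ = λ x y z → residuatedˡ y x z
  }
  where open UnitalResiduatedBinar A

MultiplicationIsMeet : ∀ {c ℓ} → UnitalResiduatedBinar c ℓ → Set (c ⊔ ℓ)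
MultiplicationIsMeet A = ∀ x y → x · y ≈ x ∧ y
  where open UnitalResiduatedBinar A

multiplicationIsMeet-opposite : ∀ {c ℓ} (A : UnitalResiduatedBinar c ℓ) →
  MultiplicationIsMeet A → MultiplicationIsMeet (opposite A)
multiplicationIsMeet-opposite A ·≈∧ x y = trans (·≈∧ y x) (∧-comm y x)
  where
  open UnitalResiduatedBinar A
  open IsLattice isLattice

module BooleanUnitalResiduatedBinar {c ℓ} (A : UnitalResiduatedBinar c ℓ)
  (boolean : UnitalResiduatedBinar.IsBooleanReduct A) where

  open UnitalResiduatedBinar A hiding (_≤_; isLattice)
  open Algebra.Definitions _≈_ using (LeftZero; _DistributesOverʳ_)

  booleanAlgebra : BooleanAlgebra c ℓ
  booleanAlgebra = record { isBooleanAlgebra = proj₂ (proj₂ (proj₂ boolean)) }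

  open BooleanAlgebra booleanAlgebra
    using (¬_; ⊤; ⊥; setoid; refl; sym; trans; ∧-comm; ∧-cong; ∨-cong; ∧-congˡ; ∨-congʳ
          ; ∧-distribˡ-∨; ∨-complementˡ; ∨-complementʳ; ∧-complementʳ)
  open BooleanAlgebraProperties booleanAlgebra
    using (∨-∧-orderTheoreticLattice; ∧-identityʳ; ∧-identityˡ; ∧-zeroˡ; ∨-identityˡ; deMorgan₁
          ; ∧-⊤-isCommutativeMonoid; ∨-⊥-isCommutativeMonoid; ∧-idem; ∨-idem)
  open OrderTheoretic.Lattice ∨-∧-orderTheoreticLattice
    using (poset; joinSemilattice; x∧y≤x; x∧y≤y; ∧-greatest; x≤x∨y; y≤x∨y; ∨-least)
    renaming (refl to ≤-refl; reflexive to ≤-reflexive; trans to ≤-trans; antisym to ≤-antisym)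
  open JoinSemilatticeProperties joinSemilattice using (∨-monotonic)

  ∧-idempotentCommutativeMonoid : IdempotentCommutativeMonoid c ℓ
  ∧-idempotentCommutativeMonoid = record
    { isIdempotentCommutativeMonoid = record
      { isCommutativeMonoid = ∧-⊤-isCommutativeMonoid
      ; idem                = ∧-idem
      }
    }

  ∨-idempotentCommutativeMonoid : IdempotentCommutativeMonoid c ℓ
  ∨-idempotentCommutativeMonoid = record
    { isIdempotentCommutativeMonoid = record
      { isCommutativeMonoid = ∨-⊥-isCommutativeMonoid
      ; idem                = ∨-idem
      }
    }

  open IdempotentCommutativeMonoidProperties ∧-idempotentCommutativeMonoid
    using () renaming (∙-distrˡ-∙ to ∧-distribˡ-∧)
  open IdempotentCommutativeMonoidProperties ∨-idempotentCommutativeMonoid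
    using () renaming (∙-distrˡ-∙ to ∨-distribˡ-∨; ∙-distrʳ-∙ to ∨-distribʳ-∨)

  -- The library's natural order, so that its lattice lemmas apply verbatim; residuation in
  -- Defs uses the symmetric form x ∧ y ≈ x, hence the sym in the four lemmas below.
  infix 3 _≤_
  _≤_ : Rel Carrier ℓ
  x ≤ y = x ≈ x ∧ y

  x≤⊤ : ∀ x → x ≤ ⊤
  x≤⊤ x = sym (∧-identityʳ x)

  ⊥≤x : ∀ x → ⊥ ≤ x
  ⊥≤x x = sym (∧-zeroˡ x)

  ·≤⇒≤⧸ : ∀ {x y z} → x · y ≤ z → x ≤ z ⧸ y
  ·≤⇒≤⧸ p = sym (Equivalence.to (residuatedˡ _ _ _) (sym p))

  ≤⧸⇒·≤ : ∀ {x y z} → x ≤ z ⧸ y → x · y ≤ z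
  ≤⧸⇒·≤ p = sym (Equivalence.from (residuatedˡ _ _ _) (sym p))

  ·≤⇒≤⧵ : ∀ {x y z} → x · y ≤ z → y ≤ x ⧵ z
  ·≤⇒≤⧵ p = sym (Equivalence.to (residuatedʳ _ _ _) (sym p))

  ≤⧵⇒·≤ : ∀ {x y z} → y ≤ x ⧵ z → x · y ≤ z
  ≤⧵⇒·≤ p = sym (Equivalence.from (residuatedʳ _ _ _) (sym p))

  ·-monoˡ-≤ : ∀ {x x′} y → x ≤ x′ → x · y ≤ x′ · y
  ·-monoˡ-≤ y x≤x′ = ≤⧸⇒·≤ (≤-trans x≤x′ (·≤⇒≤⧸ ≤-refl))

  ·-monoʳ-≤ : ∀ x {y y′} → y ≤ y′ → x · y ≤ x · y′
  ·-monoʳ-≤ x y≤y′ = ≤⧵⇒·≤ (≤-trans y≤y′ (·≤⇒≤⧵ ≤-refl))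

  ·-distribʳ-∨ : _·_ DistributesOverʳ _∨_
  ·-distribʳ-∨ x y z = ≤-antisym
    (≤⧸⇒·≤ (∨-least (·≤⇒≤⧸ (x≤x∨y (y · x) (z · x))) (·≤⇒≤⧸ (y≤x∨y (y · x) (z · x)))))
    (∨-least (·-monoˡ-≤ x (x≤x∨y y z)) (·-monoˡ-≤ x (y≤x∨y y z)))

  ·-zeroˡ : LeftZero ⊥ _·_
  ·-zeroˡ x = ≤-antisym (≤⧸⇒·≤ (⊥≤x (⊥ ⧸ x))) (⊥≤x (⊥ · x))

  e≤y⇒y⧵x≤x : ∀ {y} x → e ≤ y → y ⧵ x ≤ x
  e≤y⇒y⧵x≤x {y} x e≤y = begin
    y ⧵ x        ≈⟨ proj₁ ·-identity (y ⧵ x) ⟨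
    e · (y ⧵ x)  ≤⟨ ·-monoˡ-≤ (y ⧵ x) e≤y ⟩
    y · (y ⧵ x)  ≤⟨ ≤⧵⇒·≤ ≤-refl ⟩
    x            ∎
    where open ≤-Reasoning poset

  ∧≤⇒≤¬∨ : ∀ {x y z} → x ∧ y ≤ z → y ≤ ¬ x ∨ z
  ∧≤⇒≤¬∨ {x} {y} {z} x∧y≤z = begin
    y                  ≈⟨ ∧-identityʳ y ⟨
    y ∧ ⊤              ≈⟨ ∧-congˡ (∨-complementˡ x) ⟨
    y ∧ (¬ x ∨ x)      ≈⟨ ∧-distribˡ-∨ y (¬ x) x ⟩
    y ∧ ¬ x ∨ y ∧ x    ≤⟨ ∨-monotonic (x∧y≤y y (¬ x)) (≤-trans (≤-reflexive (∧-comm y x)) x∧y≤z) ⟩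
    ¬ x ∨ z            ∎
    where open ≤-Reasoning poset

  ≤¬∨⇒∧≤ : ∀ {x y z} → y ≤ ¬ x ∨ z → x ∧ y ≤ z
  ≤¬∨⇒∧≤ {x} {y} {z} y≤¬x∨z = begin
    x ∧ y              ≤⟨ ∧-greatest (x∧y≤x x y) (≤-trans (x∧y≤y x y) y≤¬x∨z) ⟩
    x ∧ (¬ x ∨ z)      ≈⟨ ∧-distribˡ-∨ x (¬ x) z ⟩
    x ∧ ¬ x ∨ x ∧ z    ≈⟨ ∨-congʳ (∧-complementʳ x) ⟩
    ⊥ ∨ x ∧ z          ≈⟨ ∨-identityˡ (x ∧ z) ⟩
    x ∧ z              ≤⟨ x∧y≤y x z ⟩
    z                  ∎
    where open ≤-Reasoning poset

  ⊤·-deflationary⇒·≈∧ : (∀ w → ⊤ · w ≤ w) → MultiplicationIsMeet A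
  ⊤·-deflationary⇒·≈∧ ⊤w≤w x y =
    ≤-antisym (∧-greatest (ab≤a x y) xy≤y) (≤¬∨⇒∧≤ y≤¬x∨xy)
    where
    open ≤-Reasoning poset

    e≈⊤ : e ≈ ⊤
    e≈⊤ = ≤-antisym (x≤⊤ e) (begin
      ⊤      ≈⟨ proj₂ ·-identity ⊤ ⟨
      ⊤ · e  ≤⟨ ⊤w≤w e ⟩
      e      ∎)

    ab≤a : ∀ a b → a · b ≤ a
    ab≤a a b = begin
      a · b  ≤⟨ ·-monoʳ-≤ a (x≤⊤ b) ⟩
      a · ⊤  ≈⟨ ·-cong refl e≈⊤ ⟨
      a · e  ≈⟨ proj₂ ·-identity a ⟩
      a      ∎

    xy≤y : x · y ≤ y
    xy≤y = ≤-trans (·-monoˡ-≤ y (x≤⊤ x)) (⊤w≤w y)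

    y≤¬x∨xy : y ≤ ¬ x ∨ x · y
    y≤¬x∨xy = begin
      y                ≈⟨ proj₁ ·-identity y ⟨
      e · y            ≈⟨ ·-cong (trans e≈⊤ (sym (∨-complementˡ x))) refl ⟩
      (¬ x ∨ x) · y    ≈⟨ ·-distribʳ-∨ y (¬ x) x ⟩
      ¬ x · y ∨ x · y  ≤⟨ ∨-monotonic (ab≤a (¬ x) y) ≤-refl ⟩
      ¬ x ∨ x · y      ∎

  ¬e·⊤≤⊥⇒⊤·-deflationary : ¬ e · ⊤ ≤ ⊥ → ∀ w → ⊤ · w ≤ w
  ¬e·⊤≤⊥⇒⊤·-deflationary ¬e⊤≤⊥ w = begin
    ⊤ · w            ≈⟨ ·-cong (∨-complementʳ e) refl ⟨
    (e ∨ ¬ e) · w    ≈⟨ ·-distribʳ-∨ w e (¬ e) ⟩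
    e · w ∨ ¬ e · w  ≤⟨ ∨-least (≤-reflexive (proj₁ ·-identity w)) ¬e·w≤w ⟩
    w                ∎
    where
    open ≤-Reasoning poset

    ¬e·w≤w : ¬ e · w ≤ w
    ¬e·w≤w = begin
      ¬ e · w  ≤⟨ ·-monoʳ-≤ (¬ e) (x≤⊤ w) ⟩
      ¬ e · ⊤  ≤⟨ ¬e⊤≤⊥ ⟩
      ⊥        ≤⟨ ⊥≤x w ⟩
      w        ∎

  ·-distribʳ-∧⇒¬e·⊤≤⊥ : Identity₆ (suc zero) → ¬ e · ⊤ ≤ ⊥
  ·-distribʳ-∧⇒¬e·⊤≤⊥ ·-distribʳ-∧ = ≤-reflexive (begin
    ¬ e · ⊤            ≈⟨ ∧-identityˡ (¬ e · ⊤) ⟨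
    ⊤ ∧ ¬ e · ⊤        ≈⟨ ∧-cong (proj₁ ·-identity ⊤) refl ⟨
    e · ⊤ ∧ ¬ e · ⊤    ≈⟨ ·-distribʳ-∧ e (¬ e) ⊤ ⟨
    (e ∧ ¬ e) · ⊤      ≈⟨ ·-cong (∧-complementʳ e) refl ⟩
    ⊥ · ⊤              ≈⟨ ·-zeroˡ ⊤ ⟩
    ⊥                  ∎)
    where open ≈-Reasoning setoid

  ⧵-distribˡ-∨⇒⊤·-deflationary : Identity₆ (suc (suc zero)) → ∀ w → ⊤ · w ≤ w
  ⧵-distribˡ-∨⇒⊤·-deflationary ⧵-distribˡ-∨ w =
    ≤⧵⇒·≤ (≤-trans (≤-reflexive (sym (∧-identityʳ w))) (≤¬∨⇒∧≤ ⊤≤¬w∨⊤⧵w))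
    where
    open ≤-Reasoning poset

    ⊤≤¬w∨⊤⧵w : ⊤ ≤ ¬ w ∨ ⊤ ⧵ w
    ⊤≤¬w∨⊤⧵w = begin
      ⊤                  ≤⟨ ·≤⇒≤⧵ (x≤⊤ (⊤ · ⊤)) ⟩
      ⊤ ⧵ ⊤              ≈⟨ ⧵-cong refl (∨-complementˡ w) ⟨
      ⊤ ⧵ (¬ w ∨ w)      ≈⟨ ⧵-distribˡ-∨ ⊤ (¬ w) w ⟩
      ⊤ ⧵ ¬ w ∨ ⊤ ⧵ w    ≤⟨ ∨-monotonic (e≤y⇒y⧵x≤x (¬ w) (x≤⊤ e)) ≤-refl ⟩
      ¬ w ∨ ⊤ ⧵ w        ∎

  ⧵-distribʳ-∧⇒¬e·⊤≤⊥ : Identity₆ (suc (suc (suc (suc zero)))) → ¬ e · ⊤ ≤ ⊥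
  ⧵-distribʳ-∧⇒¬e·⊤≤⊥ ⧵-distribʳ-∧ = ≤⧵⇒·≤ (begin
    ⊤                    ≤⟨ ·≤⇒≤⧵ (≤-reflexive (·-zeroˡ ⊤)) ⟩
    ⊥ ⧵ ⊥                ≈⟨ ⧵-cong (∧-complementʳ e) refl ⟨
    (e ∧ ¬ e) ⧵ ⊥        ≈⟨ ⧵-distribʳ-∧ e (¬ e) ⊥ ⟩
    e ⧵ ⊥ ∨ ¬ e ⧵ ⊥      ≤⟨ ∨-least (≤-trans (e≤y⇒y⧵x≤x ⊥ ≤-refl) (⊥≤x (¬ e ⧵ ⊥))) ≤-refl ⟩
    ¬ e ⧵ ⊥              ∎)
    where open ≤-Reasoning poset

  ·≈∧⇒⧵≈¬∨ : MultiplicationIsMeet A → ∀ x y → x ⧵ y ≈ ¬ x ∨ y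
  ·≈∧⇒⧵≈¬∨ ·≈∧ x y = ≤-antisym
    (∧≤⇒≤¬∨ (≤-trans (≤-reflexive (sym (·≈∧ x (x ⧵ y)))) (≤⧵⇒·≤ ≤-refl)))
    (·≤⇒≤⧵ (≤-trans (≤-reflexive (·≈∧ x (¬ x ∨ y))) (≤¬∨⇒∧≤ ≤-refl)))

  ·≈∧⇒·-distribˡ-∧ : MultiplicationIsMeet A → Identity₆ zero
  ·≈∧⇒·-distribˡ-∧ ·≈∧ x y z = begin
    x · (y ∧ z)        ≈⟨ ·≈∧ x (y ∧ z) ⟩
    x ∧ y ∧ z          ≈⟨ ∧-distribˡ-∧ x y z ⟩
    (x ∧ y) ∧ (x ∧ z)  ≈⟨ ∧-cong (·≈∧ x y) (·≈∧ x z) ⟨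
    x · y ∧ x · z      ∎
    where open ≈-Reasoning setoid

  ·≈∧⇒⧵-distribˡ-∨ : MultiplicationIsMeet A → Identity₆ (suc (suc zero))
  ·≈∧⇒⧵-distribˡ-∨ ·≈∧ x y z = begin
    x ⧵ (y ∨ z)            ≈⟨ ·≈∧⇒⧵≈¬∨ ·≈∧ x (y ∨ z) ⟩
    ¬ x ∨ y ∨ z            ≈⟨ ∨-distribˡ-∨ (¬ x) y z ⟩
    (¬ x ∨ y) ∨ (¬ x ∨ z)  ≈⟨ ∨-cong (·≈∧⇒⧵≈¬∨ ·≈∧ x y) (·≈∧⇒⧵≈¬∨ ·≈∧ x z) ⟨
    x ⧵ y ∨ x ⧵ z          ∎
    where open ≈-Reasoning setoid

  ·≈∧⇒⧵-distribʳ-∧ : MultiplicationIsMeet A → Identity₆ (suc (suc (suc (suc zero))))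
  ·≈∧⇒⧵-distribʳ-∧ ·≈∧ x y z = begin
    (x ∧ y) ⧵ z            ≈⟨ ·≈∧⇒⧵≈¬∨ ·≈∧ (x ∧ y) z ⟩
    ¬ (x ∧ y) ∨ z          ≈⟨ ∨-cong (deMorgan₁ x y) refl ⟩
    (¬ x ∨ ¬ y) ∨ z        ≈⟨ ∨-distribʳ-∨ z (¬ x) (¬ y) ⟩
    (¬ x ∨ z) ∨ (¬ y ∨ z)  ≈⟨ ∨-cong (·≈∧⇒⧵≈¬∨ ·≈∧ x z) (·≈∧⇒⧵≈¬∨ ·≈∧ y z) ⟨
    x ⧵ z ∨ y ⧵ z          ∎
    where open ≈-Reasoning setoid

  ·-distribʳ-∧⇒·≈∧ : Identity₆ (suc zero) → MultiplicationIsMeet A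
  ·-distribʳ-∧⇒·≈∧ =
    ⊤·-deflationary⇒·≈∧ ∘ ¬e·⊤≤⊥⇒⊤·-deflationary ∘ ·-distribʳ-∧⇒¬e·⊤≤⊥

  ⧵-distribˡ-∨⇒·≈∧ : Identity₆ (suc (suc zero)) → MultiplicationIsMeet A
  ⧵-distribˡ-∨⇒·≈∧ = ⊤·-deflationary⇒·≈∧ ∘ ⧵-distribˡ-∨⇒⊤·-deflationary

  ⧵-distribʳ-∧⇒·≈∧ : Identity₆ (suc (suc (suc (suc zero)))) → MultiplicationIsMeet A
  ⧵-distribʳ-∧⇒·≈∧ =
    ⊤·-deflationary⇒·≈∧ ∘ ¬e·⊤≤⊥⇒⊤·-deflationary ∘ ⧵-distribʳ-∧⇒¬e·⊤≤⊥

module _ {c ℓ} (A : UnitalResiduatedBinar c ℓ)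
  (boolean : UnitalResiduatedBinar.IsBooleanReduct A) where

  open UnitalResiduatedBinar A using (Identity₆)
  private
    module 𝐀 = BooleanUnitalResiduatedBinar A boolean
    module 𝐀ᵒᵖ = BooleanUnitalResiduatedBinar (opposite A) boolean

  -- Each identity of the opposite algebra is one of the six for A, up to renaming variables.
  identity⇒·≈∧ : ∀ i → Identity₆ i → MultiplicationIsMeet A
  identity⇒·≈∧ zero h =
    multiplicationIsMeet-opposite (opposite A) (𝐀ᵒᵖ.·-distribʳ-∧⇒·≈∧ λ x y z → h z x y)
  identity⇒·≈∧ (suc zero) = 𝐀.·-distribʳ-∧⇒·≈∧
  identity⇒·≈∧ (suc (suc zero)) = 𝐀.⧵-distribˡ-∨⇒·≈∧
  identity⇒·≈∧ (suc (suc (suc zero))) h =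
    multiplicationIsMeet-opposite (opposite A) (𝐀ᵒᵖ.⧵-distribˡ-∨⇒·≈∧ λ x y z → h y z x)
  identity⇒·≈∧ (suc (suc (suc (suc zero)))) = 𝐀.⧵-distribʳ-∧⇒·≈∧
  identity⇒·≈∧ (suc (suc (suc (suc (suc zero))))) h =
    multiplicationIsMeet-opposite (opposite A) (𝐀ᵒᵖ.⧵-distribʳ-∧⇒·≈∧ λ x y z → h z x y)

  ·≈∧⇒identity : MultiplicationIsMeet A → ∀ j → Identity₆ j
  ·≈∧⇒identity ·≈∧ zero = 𝐀.·≈∧⇒·-distribˡ-∧ ·≈∧
  ·≈∧⇒identity ·≈∧ (suc zero) x y z =
    𝐀ᵒᵖ.·≈∧⇒·-distribˡ-∧ (multiplicationIsMeet-opposite A ·≈∧) z x y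
  ·≈∧⇒identity ·≈∧ (suc (suc zero)) = 𝐀.·≈∧⇒⧵-distribˡ-∨ ·≈∧
  ·≈∧⇒identity ·≈∧ (suc (suc (suc zero))) x y z =
    𝐀ᵒᵖ.·≈∧⇒⧵-distribˡ-∨ (multiplicationIsMeet-opposite A ·≈∧) z x y
  ·≈∧⇒identity ·≈∧ (suc (suc (suc (suc zero)))) = 𝐀.·≈∧⇒⧵-distribʳ-∧ ·≈∧
  ·≈∧⇒identity ·≈∧ (suc (suc (suc (suc (suc zero))))) x y z =
    𝐀ᵒᵖ.·≈∧⇒⧵-distribʳ-∧ (multiplicationIsMeet-opposite A ·≈∧) y z x

corollary4p5 : ∀ {c ℓ : Level} (A : UnitalResiduatedBinar c ℓ) →
    UnitalResiduatedBinar.IsBooleanReduct A →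
    ∀ (i j : Fin 6) →
      UnitalResiduatedBinar.Identity₆ A i → UnitalResiduatedBinar.Identity₆ A j
corollary4p5 A boolean i j h = ·≈∧⇒identity A boolean (identity⇒·≈∧ A boolean i h) j
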